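{- Let $G=(A\cup B,E)$ be a marriage instance with critical set $C\subseteq A$, let $G''$ be the instance constructed from $G$ as described in the context, and let $M''$ be a stable matching of $G''$. If some copy $m^i$ of a man $m\in A$ is matched in $M''$ to a non-dummy woman, then for every copy $m^j$ of $m$ with $j>i$, $m^j$ is matched in $M''$ to the dummy woman $d_m^j$ (the first dummy woman on the list of $m^j$).
   Context: A marriage instance is a bipartite graph $G=(A\cup B,E)$ ($A$ men, $B$ women) with strict preference lists; $\mathrm{Pref}(v)$ denotes the list of $v$; every vertex prefers being matched to being unmatched. A matching is stable if no edge $(a,b)$ outside it has both endpoints preferring each other to their current partners. Construction of $G''$: let $\ell=|C|$. For $m\in C$, $A''$ contains copies $m^0,\dots,m^{\ell+1}$ and $B''$ contains dummies $d_m^1,\dots,d_m^{\ell+1}$. For $m\in A\setminus C$, $A''$ contains copies $m^0,m^1$ and one dummy $d_m^1$. $B''$ also contains all of $B$. Preferences: for $m\in A\setminus C$: $m^0$: $\mathrm{Pref}(m)$ then $d_m^1$; $m^1$: $d_m^1$ then $\mathrm{Pref}(m)$. For $m\in C$: $m^0$: $\mathrm{Pref}(m)$ then $d_m^1$; $m^i$ ($1\le i\le\ell$): $d_m^i$, $\mathrm{Pref}(m)$, $d_m^{i+1}$; $m^{\ell+1}$: $d_m^{\ell+1}$ then $\mathrm{Pref}(m)$. For $w\in B$: the existing level-$(\ell+1)$ copies of the men of $\mathrm{Pref}(w)$ in the order of $\mathrm{Pref}(w)$, then the level-$\ell$ copies, and so on down to level $0$. For a dummy $d_m^i$: $m^{i-1}$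 then $m^i$. -}

module Defs where

open import Data.Nat using (ℕ; zero; suc; _≤_; _<_; _≤?_; s≤s; z≤n)
open import Data.Nat.Properties using (≤-trans; n≤1+n; ≤-refl)
open import Data.Fin using (Fin)
open import Data.Fin.Subset using (Subset; ∣_∣)
open import Data.Vec using (lookup)
open import Data.Bool using (if_then_else_)
open import Data.List using (List; []; _∷_; _++_; map; concatMap; downFrom)
open import Data.List.Membership.Propositional using (_∈_)
open import Data.List.Relation.Unary.Unique.Propositional using (Unique)
open import Data.Maybe using (Maybe; just; nothing)
open import Data.Product using (Σ; ∃; _×_; _,_)
open import Data.Sum using (_⊎_; inj₁; inj₂)
open import Relation.Binary.PropositionalEquality using (_≡_; _≢_)
open import Relation.Nullary using (¬_; yes; no)
open import Function.Bundles using (_⇔_)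

-- x occurs strictly before y in the list l (i.e. x is preferred to y)
Before : {A : Set} → List A → A → A → Set
Before l x y = ∃ λ l₁ → ∃ λ l₂ → ∃ λ l₃ → l ≡ l₁ ++ (x ∷ l₂ ++ (y ∷ l₃))

record Instance : Set₁ where
  field
    Man   : Set
    Woman : Set
    prefM : Man → List Woman
    prefW : Woman → List Man

record Matching (I : Instance) : Set where
  open Instance I
  field
    mate       : Man → Maybe Woman
    acceptable : ∀ m w → mate m ≡ just w → (w ∈ prefM m) × (m ∈ prefW w)
    injective  : ∀ m m' w → mate m ≡ just w → mate m' ≡ just w → m ≡ m'

module _ {I : Instance} (M : Matching I) where
  open Instance I
  open Matching M

  ManPrefers : Man → Woman → Set
  ManPrefers m w = (mate m ≡ nothing)
                 ⊎ (∃ λ w' → (mate m ≡ just w') × Before (prefM m) w w')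

  WomanPrefers : Woman → Man → Set
  WomanPrefers w m = (∀ m' → mate m' ≢ just w)
                   ⊎ (∃ λ m' → (mate m' ≡ just w) × Before (prefW w) m m')

  BlockingPair : Man → Woman → Set
  BlockingPair m w = (w ∈ prefM m) × (m ∈ prefW w) × (mate m ≢ just w)
                   × ManPrefers m w × WomanPrefers w m

Stable : (I : Instance) → Matching I → Set
Stable I M = ∀ m w → ¬ BlockingPair M m w

record MarriageInstance (nA nB : ℕ) : Set where
  field
    Pref-A   : Fin nA → List (Fin nB)
    Pref-B   : Fin nB → List (Fin nA)
    strict-A : ∀ m → Unique (Pref-A m)
    strict-B : ∀ w → Unique (Pref-B w)
    edges    : ∀ m w → (w ∈ Pref-A m) ⇔ (m ∈ Pref-B w)

toInstance : ∀ {nA nB} → MarriageInstance nA nB → Instance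
toInstance {nA} {nB} G = record
  { Man = Fin nA ; Woman = Fin nB
  ; prefM = MarriageInstance.Pref-A G ; prefW = MarriageInstance.Pref-B G }

module Construction {nA nB : ℕ} (G : MarriageInstance nA nB) (C : Subset nA) where
  open MarriageInstance G

  ℓ : ℕ
  ℓ = ∣ C ∣

  top : Fin nA → ℕ
  top m = if lookup C m then suc ℓ else 1

  Man'' : Set
  Man'' = Σ (Fin nA) λ m → Σ ℕ λ i → i ≤ top m

  Dummy : Set
  Dummy = Σ (Fin nA) λ m → Σ ℕ λ j → (1 ≤ j) × (j ≤ top m)

  Woman'' : Set
  Woman'' = Fin nB ⊎ Dummy

  copy : (m : Fin nA) (i : ℕ) → i ≤ top m → Man''
  copy m i h = m , i , h

  dummy : (m : Fin nA) (j : ℕ) → 1 ≤ j → j ≤ top m → Woman''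
  dummy m j p h = inj₂ (m , j , p , h)

  dummyAt : Fin nA → ℕ → List Woman''
  dummyAt m zero = []
  dummyAt m (suc j) with suc j ≤? top m
  ... | yes h = dummy m (suc j) (s≤s z≤n) h ∷ []
  ... | no _  = []

  realPref : Fin nA → List Woman''
  realPref m = map inj₁ (Pref-A m)

  -- Pref(m^0) = Pref(m), d_m^1
  -- Pref(m^i) = d_m^i, Pref(m), d_m^(i+1)   (1 ≤ i < top m)
  -- Pref(m^top) = d_m^top, Pref(m)
  prefM'' : Man'' → List Woman''
  prefM'' (m , zero , _) = realPref m ++ dummyAt m 1
  prefM'' (m , suc i , h) = dummyAt m (suc i) ++ realPref m ++ dummyAt m (suc (suc i))

  copyAt : ℕ → Fin nA → List Man''
  copyAt i m with i ≤? top m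
  ... | yes h = copy m i h ∷ []
  ... | no _  = []

  -- Pref(w) for w ∈ B: level-(ℓ+1) copies of Pref(w) (in order), then level ℓ, …, level 0
  -- Pref(d_m^j) = m^(j-1), m^j
  prefW'' : Woman'' → List Man''
  prefW'' (inj₁ w) = concatMap (λ i → concatMap (copyAt i) (Pref-B w)) (downFrom (suc (suc ℓ)))
  prefW'' (inj₂ (m , suc j , s≤s z≤n , h)) =
    copy m j (≤-trans (n≤1+n j) h) ∷ copy m (suc j) h ∷ []

  G'' : Instance
  G'' = record { Man = Man'' ; Woman = Woman'' ; prefM = prefM'' ; prefW = prefW'' }

-- The dummy d_m^(k+1) heads the list of m^(k+1) and accepts only m^k and m^(k+1).
-- So if m^k is not matched to d_m^(k+1), stability forces m^(k+1) onto her: otherwise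
-- the two would block. A non-dummy partner of m^i releases d_m^(i+1), after which m^(i+1)
-- holds d_m^(i+1) and hence releases d_m^(i+2), and so on up the copies of m.
module Submission where

open import Defs
open import Data.Nat using (ℕ; zero; suc; _≤_; _<_; _≤′_; ≤′-refl; ≤′-step; s≤s; z≤n; _≤?_)
open import Data.Nat.Properties using (≤-irrelevant; ≤-trans; n≤1+n; ≤⇒≤′; 1+n≢n)
open import Data.Fin using (Fin)
open import Data.Fin.Subset using (Subset)
open import Data.Maybe using (just; nothing)
open import Data.Maybe.Properties using (just-injective)
open import Data.Sum using (inj₁; inj₂)
open import Data.Product using (Σ; _,_; proj₁; proj₂)
open import Data.List using ([]; _∷_; _++_)
open import Data.List.Membership.Propositional using (_∈_; _∉_)
open import Data.List.Membership.Propositional.Properties using (∈-∃++; ∈-++⁻; ∈-map⁻)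
open import Data.List.Relation.Unary.Any using (here; there)
open import Data.Empty using (⊥-elim)
open import Relation.Nullary using (yes; no)
open import Relation.Binary.PropositionalEquality using (_≡_; _≢_; refl; sym; trans; cong; subst)

module _ {I : Instance} (M : Matching I) (stable : Stable I M) where
  open Instance I
  open Matching M

  stable⇒first-choice-matched : ∀ {m w ws} → prefM m ≡ w ∷ ws → w ∉ ws → m ∈ prefW w →
    (∀ m' → mate m' ≡ just w → m' ≡ m) → mate m ≡ just w
  stable⇒first-choice-matched {m} {w} {ws} pref-m w∉ws m∈w only-m = by-cases (mate m) refl
    where
    w∈m : w ∈ prefM m
    w∈m = subst (w ∈_) (sym pref-m) (here refl)

    w-free-unless-m : mate m ≢ just w → ∀ m' → mate m' ≢ just w
    w-free-unless-m m↛w m' m'↦w with only-m m' m'↦w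
    ... | refl = m↛w m'↦w

    blocks : mate m ≢ just w → ManPrefers M m w → BlockingPair M m w
    blocks m↛w prefers = w∈m , m∈w , m↛w , prefers , inj₁ (w-free-unless-m m↛w)

    by-cases : ∀ r → mate m ≡ r → mate m ≡ just w
    by-cases nothing m↦r = ⊥-elim (stable m w (blocks m↛w (inj₁ m↦r)))
      where
      m↛w : mate m ≢ just w
      m↛w m↦w with trans (sym m↦r) m↦w
      ... | ()
    by-cases (just w') m↦w' with subst (w' ∈_) pref-m (proj₁ (acceptable m w' m↦w'))
    ... | here refl = m↦w'
    ... | there w'∈ws = ⊥-elim (stable m w (blocks m↛w (inj₂ (w' , m↦w' , w-before-w'))))
      where
      m↛w : mate m ≢ just w
      m↛w m↦w with just-injective (trans (sym m↦w') m↦w)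
      ... | refl = w∉ws w'∈ws

      w-before-w' : Before (prefM m) w w'
      w-before-w' with ∈-∃++ w'∈ws
      ... | l₂ , l₃ , ws≡ = [] , l₂ , l₃ , trans pref-m (cong (w ∷_) ws≡)

module _ {nA nB} (G : MarriageInstance nA nB) (C : Subset nA) where
  open Construction G C

  level : Woman'' → ℕ
  level (inj₁ _) = zero
  level (inj₂ (_ , j , _)) = j

  copy-irrelevant : ∀ m i (h h' : i ≤ top m) → copy m i h ≡ copy m i h'
  copy-irrelevant m i h h' = cong (copy m i) (≤-irrelevant h h')

  dummyAt-in-range : ∀ m j (h : suc j ≤ top m) → dummyAt m (suc j) ≡ dummy m (suc j) (s≤s z≤n) h ∷ []
  dummyAt-in-range m j h with suc j ≤? top m
  ... | yes h' = cong (λ h'' → dummy m (suc j) (s≤s z≤n) h'' ∷ []) (≤-irrelevant h' h)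
  ... | no ¬h = ⊥-elim (¬h h)

  level-∈-dummyAt : ∀ {m j x} → x ∈ dummyAt m j → level x ≡ j
  level-∈-dummyAt {m} {suc j} x∈ with suc j ≤? top m
  level-∈-dummyAt {m} {suc j} (here refl) | yes _ = refl

  prefM''-dummy-first : ∀ m k (h : suc k ≤ top m) → prefM'' (copy m (suc k) h)
    ≡ dummy m (suc k) (s≤s z≤n) h ∷ realPref m ++ dummyAt m (suc (suc k))
  prefM''-dummy-first m k h = cong (_++ realPref m ++ dummyAt m (suc (suc k))) (dummyAt-in-range m k h)

  dummy-not-repeated : ∀ m k (h : suc k ≤ top m) →
    dummy m (suc k) (s≤s z≤n) h ∉ realPref m ++ dummyAt m (suc (suc k))
  dummy-not-repeated m k h d∈ with ∈-++⁻ (realPref m) d∈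
  ... | inj₁ d∈real with ∈-map⁻ inj₁ d∈real
  ...   | _ , _ , ()
  dummy-not-repeated m k h d∈ | inj₂ d∈next = 1+n≢n (sym (level-∈-dummyAt d∈next))

  module _ (M'' : Matching G'') (stable : Stable G'' M'') where
    open Matching M''

    dummy-partner : ∀ m k (hk : k ≤ top m) (h : suc k ≤ top m) →
      mate (copy m k hk) ≢ just (dummy m (suc k) (s≤s z≤n) h) →
      ∀ m' → mate m' ≡ just (dummy m (suc k) (s≤s z≤n) h) → m' ≡ copy m (suc k) h
    dummy-partner m k hk h m^k↛d m' m'↦d with proj₂ (acceptable m' _ m'↦d)
    ... | here refl = ⊥-elim (m^k↛d (subst (λ c → mate c ≡ just (dummy m (suc k) (s≤s z≤n) h))
                                            (copy-irrelevant m k _ hk) m'↦d))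
    ... | there (here refl) = refl

    dummy-released : ∀ m k (hk : k ≤ top m) (h : suc k ≤ top m) →
      mate (copy m k hk) ≢ just (dummy m (suc k) (s≤s z≤n) h) →
      mate (copy m (suc k) h) ≡ just (dummy m (suc k) (s≤s z≤n) h)
    dummy-released m k hk h m^k↛d = stable⇒first-choice-matched M'' stable
      (prefM''-dummy-first m k h) (dummy-not-repeated m k h) (there (here refl))
      (dummy-partner m k hk h m^k↛d)

    higher-copies-hold-dummies : ∀ m i (hi : i ≤ top m) w → mate (copy m i hi) ≡ just (inj₁ w) →
      ∀ {k} (h : suc k ≤ top m) → i ≤′ k → mate (copy m (suc k) h) ≡ just (dummy m (suc k) (s≤s z≤n) h)
    higher-copies-hold-dummies m i hi w m^i↦w h ≤′-refl =
      dummy-released m i hi h λ m^i↦d → real≢dummy (trans (sym m^i↦w) m^i↦d)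
      where
      real≢dummy : ∀ {x} → just (inj₁ w) ≢ just (inj₂ x)
      real≢dummy ()
    higher-copies-hold-dummies m i hi w m^i↦w {suc k} h (≤′-step i≤′k) =
      dummy-released m (suc k) hk h λ m^k↦d' →
        1+n≢n (sym (cong level (just-injective (trans (sym m^k↦d) m^k↦d'))))
      where
      hk : suc k ≤ top m
      hk = ≤-trans (n≤1+n (suc k)) h
      m^k↦d : mate (copy m (suc k) hk) ≡ just (dummy m (suc k) (s≤s z≤n) hk)
      m^k↦d = higher-copies-hold-dummies m i hi w m^i↦w hk i≤′k

corollary3p1p1 : ∀ {nA nB} (G : MarriageInstance nA nB) (C : Subset nA)
    (M'' : Matching (Construction.G'' G C)) → Stable (Construction.G'' G C) M'' →
    ∀ (m : Fin nA) (i : ℕ) (hi : i ≤ Construction.top G C m) (w : Fin nB) →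
    Matching.mate M'' (Construction.copy G C m i hi) ≡ just (inj₁ w) →
    ∀ (j : ℕ) (hj : j ≤ Construction.top G C m) → i < j →
    Σ (1 ≤ j) λ p →
    Matching.mate M'' (Construction.copy G C m j hj) ≡ just (Construction.dummy G C m j p hj)
corollary3p1p1 G C M'' stable m i hi w m^i↦w (suc k) hj (s≤s i≤k) =
  s≤s z≤n , higher-copies-hold-dummies G C M'' stable m i hi w m^i↦w hj (≤⇒≤′ i≤k)
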